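{- Let $G$ be a connected $2$-edge-colored multigraph on $n\ge 4$ vertices with $m$ edges. If $m\ge 2\binom{n-1}{2}+n$, then $G$ has a proper Hamiltonian cycle if $n$ is even, and a proper cycle of length $n-1$ if $n$ is odd.
   Context: A $c$-edge-colored multigraph has each edge colored with one color from $\{1,\dots,c\}$, and no two edges joining the same pair of vertices have the same color (no loops); $m$ counts all edges including parallel ones. Throughout, multigraphs are assumed connected. A subgraph is proper if any two adjacent edges in it have different colors. A proper Hamiltonian cycle is a properly colored cycle through all vertices; the length of a cycle is its number of vertices. -}

module Defs where

open import Data.Nat using (ℕ; zero; suc; _+_; _∸_; _*_; _<_; _≥_)
open import Data.Nat.Combinatorics using (_C_)
open import Data.Fin using (Fin; toℕ; _≟_) renaming (zero to fzero; suc to fsuc)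
import Data.Nat
import Data.Fin
import Relation.Nullary
import Relation.Binary.PropositionalEquality
open import Data.Bool using (Bool; true; false; T; if_then_else_)
open import Data.List using (List; map; allFin)
open import Data.Nat.ListAction using (sum)
open import Data.Product using (Σ; _×_; ∃; ∃-syntax; _,_)
open import Relation.Binary.PropositionalEquality using (_≡_; _≢_)
open import Relation.Nullary using (¬_)
open import Function.Definitions using (Injective)

-- Since at most one edge of a given
-- colour joins a given pair, the multigraph is fully described by these
-- Boolean predicates.
record ColoredMultigraph (c n : ℕ) : Set where
  field
    edge  : Fin c → Fin n → Fin n → Bool
    sym   : ∀ col u v → edge col u v ≡ edge col v u
    loopless : ∀ col u → edge col u u ≡ false
open ColoredMultigraph public

ind : Bool → ℕ
ind true  = 1
ind false = 0

numEdges : ∀ {c n} → ColoredMultigraph c n → ℕ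
numEdges {c} {n} G =
  sum (map (λ col → sum (map (λ u → sum (map (λ v →
    if Data.Nat._<ᵇ_ (toℕ u) (toℕ v) then ind (edge G col u v) else 0)
    (allFin n))) (allFin n))) (allFin c))

Adjacent : ∀ {c n} → ColoredMultigraph c n → Fin n → Fin n → Set
Adjacent G u v = ∃[ col ] T (edge G col u v)

data Reachable {c n} (G : ColoredMultigraph c n) (u : Fin n) : Fin n → Set where
  here : Reachable G u u
  step : ∀ {v w} → Reachable G u v → Adjacent G v w → Reachable G u w

Connected : ∀ {c n} → ColoredMultigraph c n → Set
Connected G = ∀ u v → Reachable G u v

-- cyclic successor on Fin k : i ↦ i+1, and the last element ↦ 0
next : ∀ {k} → Fin k → Fin k
next {suc k} i = wrap (fsuc i)
  where
  wrap : Fin (suc (suc k)) → Fin (suc k)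
  wrap j with Data.Fin.toℕ j Data.Nat.≟ suc k
  ... | Relation.Nullary.yes _ = fzero
  ... | Relation.Nullary.no ne = Data.Fin.lower₁ j (λ eq → ne (Relation.Binary.PropositionalEquality.sym eq))

record ProperCycle {c n} (G : ColoredMultigraph c n) (k : ℕ) : Set where
  field
    length≥3 : k ≥ 3
    vs       : Fin k → Fin n
    distinct : Injective _≡_ _≡_ vs
    cs       : Fin k → Fin c
    edges    : ∀ i → T (edge G (cs i) (vs i) (vs (next i)))
    proper   : ∀ i → cs i ≢ cs (next i)

ProperHamiltonianCycle : ∀ {c n} → ColoredMultigraph c n → Set
ProperHamiltonianCycle {n = n} G = ProperCycle G n

module Submission where

-- For odd q, the complete 2-coloured multigraph on ℤ_q ∪ {∞} splits into q properly coloured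
-- Hamiltonian cycles: cycle c runs ∞, c, c+2, c−2, c+4, c−4, …, c+1 with alternating colours,
-- and its edges of colour b are exactly the pairs {x, y} with x + y ≡ 2c + 2b (mod q), where
-- {∞, y} counts as 2y.  As q is odd, 2c + 2b determines c, so the cycles are edge-disjoint.
-- If G contains none of them, each misses a coloured edge of G, and these are distinct: G lacks
-- q of its possible coloured edges.  For n even take q = n − 1.  For n odd take q = n − 2 and
-- place the cycles on the vertices other than u, for some coloured edge uv missing from G (if
-- there is none, any placement yields a cycle); then uv is one more missing edge.  Either way
-- G has at most 2·C(n,2) − (n − 1) edges, below 2·C(n−1,2) + n = 2·C(n,2) − n + 2.

open import Defs hiding (sym)
open import Data.Nat using (ℕ; _+_; _*_; _∸_; _≥_)
open import Data.Nat.Combinatorics using (_C_)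
open import Data.Nat.Divisibility using (_∣_)
open import Data.Product using (_×_)
open import Relation.Nullary using (¬_)

open import Data.Bool using (true; false; if_then_else_; T)
open import Data.Bool.Properties using (T-≡; ¬-not)
open import Data.Empty using (⊥-elim)
open import Data.Fin as Fin
  using (Fin; toℕ; fromℕ; fromℕ<; inject₁; punchIn; _≟_; _<?_)
  renaming (zero to fzero; suc to fsuc)
open import Data.Fin.Properties
  using ( toℕ-injective; toℕ-fromℕ; toℕ-fromℕ<; toℕ-inject₁; toℕ-lower₁; toℕ<n; toℕ≤pred[n]
        ; any?; all?; ¬∀⟶∃¬; punchIn-injective; punchInᵢ≢i)
  renaming (suc-injective to fsuc-injective)
open import Data.Fin.Relation.Unary.Top using (view; ‵fromℕ; ‵inj₁)
open import Data.List using (List; []; _∷_; map; allFin)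
open import Data.List.Properties using (map-tabulate; map-cong)
open import Data.List.Membership.Propositional using (_∈_)
open import Data.List.Membership.Propositional.Properties using (∈-allFin)
open import Data.List.Relation.Unary.Any using (here; there)
open import Data.Nat.Base using (zero; suc; _≤_; _<_; z≤n; s≤s; z<s; _<ᵇ_; _≡ᵇ_; parity; NonZero)
open import Data.Nat.Combinatorics using (nC1≡n; nCk+nC[k+1]≡[n+1]C[k+1])
open import Data.Nat.Coprimality using (Coprime; coprime-divisor)
open import Data.Nat.DivMod
  using (_%_; _/_; m≡m%n+[m/n]*n; m%n<n; %-distribˡ-+; %-remove-+ˡ; [m+n]%n≡m%n; m<n⇒m%n≡m)
open import Data.Nat.Divisibility using (divides; ∣-refl; _∣0; ∣m∣n⇒∣m+n; >⇒∤)
open import Data.Nat.ListAction using (sum)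
open import Data.Nat.Primality using (prime⇒irreducible; prime[2])
open import Data.Nat.Properties hiding (_<?_) renaming (_≟_ to _≟ℕ_)
open import Data.Nat.Solver using (module +-*-Solver)
open import Data.Parity.Base as ℙ using (Parity; 0ℙ; 1ℙ; _⁻¹)
open import Data.Parity.Properties using (+-homo-+; ⁻¹-injective) renaming (+-identityʳ to ℙ-+-identityʳ)
open import Data.Product using (_,_; proj₁; proj₂; Σ-syntax; ∃-syntax)
open import Data.Product.Properties using (≡-dec)
open import Data.Sum using (_⊎_; inj₁; inj₂)
import Data.Vec.Functional as Vector
open import Function using (Injective; Equivalence; id; _∘_)
open import Relation.Binary.PropositionalEquality
open import Relation.Nullary using (Dec; yes; no; does; contradiction)
open import Relation.Nullary.Decidable using (T?)
open import Algebra.Properties.CommutativeSemigroup +-commutativeSemigroup using (interchange)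

parity-suc : ∀ n → parity (suc n) ≡ parity n ⁻¹
parity-suc zero          = refl
parity-suc (suc zero)    = refl
parity-suc (suc (suc n)) = parity-suc n

parity[n*2]≡0ℙ : ∀ n → parity (n * 2) ≡ 0ℙ
parity[n*2]≡0ℙ zero    = refl
parity[n*2]≡0ℙ (suc n) = parity[n*2]≡0ℙ n

2∣⇒parity≡0ℙ : ∀ {n} → 2 ∣ n → parity n ≡ 0ℙ
2∣⇒parity≡0ℙ (divides k refl) = parity[n*2]≡0ℙ k

parity≡0ℙ⇒2∣ : ∀ n → parity n ≡ 0ℙ → 2 ∣ n
parity≡0ℙ⇒2∣ zero          _  = 2 ∣0
parity≡0ℙ⇒2∣ (suc (suc n)) eq = ∣m∣n⇒∣m+n ∣-refl (parity≡0ℙ⇒2∣ n eq)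

¬2∣⇒parity≡1ℙ : ∀ {n} → ¬ 2 ∣ n → parity n ≡ 1ℙ
¬2∣⇒parity≡1ℙ {n} 2∤n with parity n in eq
... | 0ℙ = contradiction (parity≡0ℙ⇒2∣ n eq) 2∤n
... | 1ℙ = refl

2∣suc⇒parity≡1ℙ : ∀ {n} → 2 ∣ suc n → parity n ≡ 1ℙ
2∣suc⇒parity≡1ℙ {n} 2∣1+n with parity n in eq
... | 1ℙ = refl
... | 0ℙ with () ← trans (sym (2∣⇒parity≡0ℙ 2∣1+n)) (trans (parity-suc n) (cong _⁻¹ eq))

parity≡1ℙ⇒coprime-2 : ∀ {n} → parity n ≡ 1ℙ → Coprime n 2
parity≡1ℙ⇒coprime-2 odd (d∣n , d∣2) with prime⇒irreducible prime[2] d∣2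
... | inj₁ d≡1 = d≡1
... | inj₂ refl with () ← trans (sym (2∣⇒parity≡0ℙ d∣n)) odd

module _ {q : ℕ} .{{_ : NonZero q}} where

  %≡%⇒∣∸ : ∀ a b → a % q ≡ b % q → q ∣ b ∸ a
  %≡%⇒∣∸ a b eq = divides (b / q ∸ a / q) (begin
    b ∸ a                                     ≡⟨ cong₂ _∸_ (m≡m%n+[m/n]*n b q) (m≡m%n+[m/n]*n a q) ⟩
    (b % q + b / q * q) ∸ (a % q + a / q * q) ≡⟨ cong (λ r → (r + b / q * q) ∸ (a % q + a / q * q)) eq ⟨
    (a % q + b / q * q) ∸ (a % q + a / q * q) ≡⟨ [m+n]∸[m+o]≡n∸o (a % q) _ _ ⟩
    b / q * q ∸ a / q * q                     ≡⟨ *-distribʳ-∸ q (b / q) (a / q) ⟨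
    (b / q ∸ a / q) * q                       ∎)
    where open ≡-Reasoning

  ∣∸∧∸<⇒≤ : ∀ {a b} → q ∣ b ∸ a → b ∸ a < q → b ≤ a
  ∣∸∧∸<⇒≤ {a} {b} q∣b∸a b∸a<q with b ∸ a in eq
  ... | zero  = m∸n≡0⇒m≤n eq
  ... | suc _ = contradiction q∣b∸a (>⇒∤ b∸a<q)

  %-injective-window : ∀ {a b} → a % q ≡ b % q → a < b + q → b < a + q → a ≡ b
  %-injective-window {a} {b} eq a<b+q b<a+q with ≤-total a b
  ... | inj₁ a≤b = ≤-antisym a≤b
                     (∣∸∧∸<⇒≤ (%≡%⇒∣∸ a b eq) (m<n+o⇒m∸n<o b a b<a+q))
  ... | inj₂ b≤a = ≤-antisym
                     (∣∸∧∸<⇒≤ (%≡%⇒∣∸ b a (sym eq)) (m<n+o⇒m∸n<o a b a<b+q)) b≤a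

  +-*-%-cancel : ∀ {a} → Coprime q a → ∀ b {c c′} →
                 (b + a * c) % q ≡ (b + a * c′) % q → c ≤ c′ → c′ < q → c ≡ c′
  +-*-%-cancel {a} coprime b {c} {c′} eq c≤c′ c′<q =
    ≤-antisym c≤c′ (∣∸∧∸<⇒≤ q∣c′∸c (≤-<-trans (m∸n≤m c′ c) c′<q))
    where
    q∣c′∸c : q ∣ c′ ∸ c
    q∣c′∸c = coprime-divisor coprime (subst (q ∣_)
      (trans ([m+n]∸[m+o]≡n∸o b (a * c′) (a * c)) (sym (*-distribˡ-∸ a c′ c)))
      (%≡%⇒∣∸ _ _ eq))

  +-*-%-injective : ∀ {a} → Coprime q a → ∀ b {c c′} →
                    (b + a * c) % q ≡ (b + a * c′) % q → c < q → c′ < q → c ≡ c′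
  +-*-%-injective coprime b {c} {c′} eq c<q c′<q with ≤-total c c′
  ... | inj₁ c≤c′ = +-*-%-cancel coprime b eq c≤c′ c′<q
  ... | inj₂ c′≤c = sym (+-*-%-cancel coprime b (sym eq) c′≤c c<q)

sum-map-mono : ∀ {A : Set} (xs : List A) {f g : A → ℕ} → (∀ x → f x ≤ g x) →
               sum (map f xs) ≤ sum (map g xs)
sum-map-mono []       f≤g = z≤n
sum-map-mono (x ∷ xs) f≤g = +-mono-≤ (f≤g x) (sum-map-mono xs f≤g)

sum-map-+ : ∀ {A : Set} (xs : List A) (f g : A → ℕ) →
            sum (map (λ x → f x + g x) xs) ≡ sum (map f xs) + sum (map g xs)
sum-map-+ []       f g = refl
sum-map-+ (x ∷ xs) f g =
  trans (cong (f x + g x +_) (sum-map-+ xs f g)) (interchange (f x) (g x) _ _)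

∈⇒≤sum-map : ∀ {A : Set} {x : A} {xs : List A} (f : A → ℕ) → x ∈ xs → f x ≤ sum (map f xs)
∈⇒≤sum-map f (here refl) = m≤m+n _ _
∈⇒≤sum-map f (there x∈xs) = ≤-trans (∈⇒≤sum-map f x∈xs) (m≤n+m _ _)

∑ : ∀ {k} → (Fin k → ℕ) → ℕ
∑ {k} f = sum (map f (allFin k))

∑-suc : ∀ {k} (f : Fin (suc k) → ℕ) → ∑ f ≡ f fzero + ∑ (f ∘ fsuc)
∑-suc f = cong (λ xs → f fzero + sum xs)
  (trans (map-tabulate fsuc f) (sym (map-tabulate (λ i → i) (f ∘ fsuc))))

∑-const : ∀ k a → ∑ {k} (λ _ → a) ≡ k * a
∑-const zero    a = refl
∑-const (suc k) a = trans (∑-suc {k} (λ _ → a)) (cong (a +_) (∑-const k a))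

∑-cong : ∀ {k} {f g : Fin k → ℕ} → (∀ i → f i ≡ g i) → ∑ f ≡ ∑ g
∑-cong {k} f≗g = cong sum (map-cong f≗g (allFin k))

∑-mono : ∀ {k} {f g : Fin k → ℕ} → (∀ i → f i ≤ g i) → ∑ f ≤ ∑ g
∑-mono {k} = sum-map-mono (allFin k)

∑-+ : ∀ {k} (f g : Fin k → ℕ) → ∑ (λ i → f i + g i) ≡ ∑ f + ∑ g
∑-+ {k} = sum-map-+ (allFin k)

∑-point : ∀ {k} (f : Fin k → ℕ) i → f i ≤ ∑ f
∑-point f i = ∈⇒≤sum-map f (∈-allFin i)

Slot : ℕ → Set
Slot n = Fin 2 × Fin n × Fin n

_≟ˢ_ : ∀ {n} (s t : Slot n) → Dec (s ≡ t)
_≟ˢ_ = ≡-dec _≟_ (≡-dec _≟_ _≟_)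

module _ {n : ℕ} where

  ∑ˢ : (Slot n → ℕ) → ℕ
  ∑ˢ f = ∑ λ col → ∑ λ u → ∑ λ v → f (col , u , v)

  ∑ˢ-mono : ∀ {f g : Slot n → ℕ} → (∀ s → f s ≤ g s) → ∑ˢ f ≤ ∑ˢ g
  ∑ˢ-mono f≤g = ∑-mono λ col → ∑-mono λ u → ∑-mono λ v → f≤g (col , u , v)

  ∑ˢ-+ : ∀ (f g : Slot n → ℕ) → ∑ˢ (λ s → f s + g s) ≡ ∑ˢ f + ∑ˢ g
  ∑ˢ-+ f g = trans
    (∑-cong λ c → trans
      (∑-cong λ x → ∑-+ (λ y → f (c , x , y)) (λ y → g (c , x , y)))
      (∑-+ (λ x → ∑ λ y → f (c , x , y)) (λ x → ∑ λ y → g (c , x , y))))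
    (∑-+ (λ c → ∑ λ x → ∑ λ y → f (c , x , y)) (λ c → ∑ λ x → ∑ λ y → g (c , x , y)))

  ∑ˢ-point : ∀ (f : Slot n → ℕ) s → f s ≤ ∑ˢ f
  ∑ˢ-point f (col , u , v) = begin
    f (col , u , v)  ≤⟨ ∑-point (λ y → f (col , u , y)) v ⟩
    row u            ≤⟨ ∑-point row u ⟩
    layer col        ≤⟨ ∑-point layer col ⟩
    ∑ˢ f             ∎
    where
    open ≤-Reasoning
    row : Fin n → ℕ
    row x = ∑ λ y → f (col , x , y)
    layer : Fin 2 → ℕ
    layer c = ∑ λ x → ∑ λ y → f (c , x , y)

  indicator : Slot n → Slot n → ℕ
  indicator t s = ind (does (s ≟ˢ t))

  ∑ˢ-indicator : ∀ t → 1 ≤ ∑ˢ (indicator t)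
  ∑ˢ-indicator t with t ≟ˢ t | ∑ˢ-point (indicator t) t
  ... | yes _ | 1≤∑ = 1≤∑
  ... | no t≢t | _ = contradiction refl t≢t

  ∑ˢ-gap : ∀ {k} {g h : Slot n → ℕ} → (∀ s → g s ≤ h s) →
           (ts : Fin k → Slot n) → Injective _≡_ _≡_ ts → (∀ i → g (ts i) < h (ts i)) →
           ∑ˢ g + k ≤ ∑ˢ h
  ∑ˢ-gap {zero} {g} {h} g≤h ts _ _ = subst (_≤ ∑ˢ h) (sym (+-identityʳ (∑ˢ g))) (∑ˢ-mono g≤h)
  ∑ˢ-gap {suc k} {g} {h} g≤h ts ts-inj g<h = begin
    ∑ˢ g + (1 + k)               ≡⟨ +-assoc (∑ˢ g) 1 k ⟨
    ∑ˢ g + 1 + k                 ≤⟨ +-monoˡ-≤ k (+-monoʳ-≤ (∑ˢ g) (∑ˢ-indicator t)) ⟩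
    ∑ˢ g + ∑ˢ (indicator t) + k  ≡⟨ cong (_+ k) (∑ˢ-+ g (indicator t)) ⟨
    ∑ˢ g′ + k                    ≤⟨ ∑ˢ-gap g′≤h (ts ∘ fsuc) (fsuc-injective ∘ ts-inj) g′<h ⟩
    ∑ˢ h                         ∎
    where
    open ≤-Reasoning
    t : Slot n
    t = ts fzero
    g′ : Slot n → ℕ
    g′ s = g s + indicator t s
    g′≤h : ∀ s → g′ s ≤ h s
    g′≤h s with s ≟ˢ t
    ... | yes refl = subst (_≤ h t) (+-comm 1 (g t)) (g<h fzero)
    ... | no _     = subst (_≤ h s) (sym (+-identityʳ (g s))) (g≤h s)
    g′<h : ∀ i → g′ (ts (fsuc i)) < h (ts (fsuc i))
    g′<h i with ts (fsuc i) ≟ˢ t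
    ... | yes eq = contradiction (ts-inj eq) λ ()
    ... | no _   = subst (_< h (ts (fsuc i))) (sym (+-identityʳ _)) (g<h (fsuc i))

ascending : ∀ {m n} → Fin m → Fin n → ℕ
ascending u v = if toℕ u <ᵇ toℕ v then 1 else 0

-- numEdges G is ∑ˢ (present G) by definition, and ∑ˢ slot counts the edges of the complete
-- 2-coloured multigraph.
slot : ∀ {n} → Slot n → ℕ
slot (_ , u , v) = ascending u v

present : ∀ {n} → ColoredMultigraph 2 n → Slot n → ℕ
present G (col , u , v) = if toℕ u <ᵇ toℕ v then ind (edge G col u v) else 0

Absent : ∀ {n} → ColoredMultigraph 2 n → Slot n → Set
Absent G (col , u , v) = u Fin.< v × edge G col u v ≡ false

present≤slot : ∀ {n} (G : ColoredMultigraph 2 n) s → present G s ≤ slot s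
present≤slot G (col , u , v) with toℕ u <ᵇ toℕ v
... | false = z≤n
... | true with edge G col u v
...   | true  = ≤-refl
...   | false = z≤n

absent⇒present<slot : ∀ {n} (G : ColoredMultigraph 2 n) {s} → Absent G s → present G s < slot s
absent⇒present<slot G {col , u , v} (u<v , no-edge)
  rewrite Equivalence.to T-≡ (<⇒<ᵇ u<v) | no-edge = ≤-refl

pairs : ℕ → ℕ
pairs k = ∑ λ (u : Fin k) → ∑ λ (v : Fin k) → ascending u v

pairs≡C2 : ∀ k → pairs k ≡ k C 2
pairs≡C2 zero    = refl
pairs≡C2 (suc k) = begin
  pairs (suc k)      ≡⟨ ∑-suc {k} (λ u → ∑ λ (v : Fin (suc k)) → ascending u v) ⟩
  first-row + rest   ≡⟨ cong₂ _+_ first-row≡k rest≡pairs ⟩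
  k + pairs k        ≡⟨ cong₂ _+_ (sym (nC1≡n k)) (pairs≡C2 k) ⟩
  k C 1 + k C 2      ≡⟨ nCk+nC[k+1]≡[n+1]C[k+1] k 1 ⟩
  suc k C 2          ∎
  where
  open ≡-Reasoning
  first-row rest : ℕ
  first-row = ∑ λ (v : Fin (suc k)) → ascending (fzero {k}) v
  rest = ∑ λ (u : Fin k) → ∑ λ (v : Fin (suc k)) → ascending (fsuc u) v
  first-row≡k : first-row ≡ k
  first-row≡k = trans (∑-suc {k} (ascending (fzero {k}))) (trans (∑-const k 1) (*-identityʳ k))
  rest≡pairs : rest ≡ pairs k
  rest≡pairs = ∑-cong {k} λ u → ∑-suc {k} (ascending (fsuc u))

∑ˢ-slot : ∀ n → ∑ˢ (slot {n}) ≡ 2 * (n C 2)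
∑ˢ-slot n = trans (∑-const 2 (pairs n)) (cong (2 *_) (pairs≡C2 n))

numEdges-bound : ∀ {n k} (G : ColoredMultigraph 2 n) (ts : Fin k → Slot n) →
                 Injective _≡_ _≡_ ts → (∀ i → Absent G (ts i)) → numEdges G + k ≤ 2 * (n C 2)
numEdges-bound {n} {k} G ts ts-inj absent = subst (numEdges G + k ≤_) (∑ˢ-slot n)
  (∑ˢ-gap (present≤slot G) ts ts-inj (λ i → absent⇒present<slot G (absent i)))

next-fromℕ : ∀ k → next (fromℕ k) ≡ fzero
next-fromℕ k with suc (toℕ (fromℕ k)) ≟ℕ suc k
... | yes _ = refl
... | no ≢k = contradiction (cong suc (toℕ-fromℕ k)) ≢k

toℕ-next-inject₁ : ∀ {k} (j : Fin k) → toℕ (next (inject₁ j)) ≡ suc (toℕ j)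
toℕ-next-inject₁ {k} j with suc (toℕ (inject₁ j)) ≟ℕ suc k
... | yes eq = contradiction (trans (sym (toℕ-inject₁ j)) (suc-injective eq)) (<⇒≢ (toℕ<n j))
... | no ne  = trans (toℕ-lower₁ (fsuc (inject₁ j)) (ne ∘ sym)) (cong suc (toℕ-inject₁ j))

_≐_ : ∀ {A : Set} → A × A → A × A → Set
(a , b) ≐ (a′ , b′) = (a ≡ a′ × b ≡ b′) ⊎ (a ≡ b′ × b ≡ a′)

≐-injective : ∀ {A B : Set} {f : A → B} → Injective _≡_ _≡_ f →
              ∀ {a b a′ b′} → (f a , f b) ≐ (f a′ , f b′) → (a , b) ≐ (a′ , b′)
≐-injective f-inj (inj₁ (eq₁ , eq₂)) = inj₁ (f-inj eq₁ , f-inj eq₂)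
≐-injective f-inj (inj₂ (eq₁ , eq₂)) = inj₂ (f-inj eq₁ , f-inj eq₂)

resp-≐ : ∀ {A B : Set} (f : A → A → B) → (∀ x y → f x y ≡ f y x) →
            ∀ {a b a′ b′} → (a , b) ≐ (a′ , b′) → f a b ≡ f a′ b′
resp-≐ f f-sym (inj₁ (refl , refl)) = refl
resp-≐ f f-sym (inj₂ (refl , refl)) = f-sym _ _

module _ {n : ℕ} where

  canon : Fin 2 → Fin n → Fin n → Slot n
  canon col a b with a <? b
  ... | yes _ = col , a , b
  ... | no  _ = col , b , a

  canon-injective : ∀ {col col′ a b a′ b′} → canon col a b ≡ canon col′ a′ b′ →
                    col ≡ col′ × (a , b) ≐ (a′ , b′)
  canon-injective {col} {col′} {a} {b} {a′} {b′} eq with a <? b | a′ <? b′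
  canon-injective refl | yes _ | yes _ = refl , inj₁ (refl , refl)
  canon-injective refl | yes _ | no  _ = refl , inj₂ (refl , refl)
  canon-injective refl | no  _ | yes _ = refl , inj₂ (refl , refl)
  canon-injective refl | no  _ | no  _ = refl , inj₁ (refl , refl)

  canon-absent : ∀ (G : ColoredMultigraph 2 n) {col a b} → a ≢ b → edge G col a b ≡ false →
                 Absent G (canon col a b)
  canon-absent G {col} {a} {b} a≢b no-edge with a <? b
  ... | yes a<b = a<b , no-edge
  ... | no  a≮b = ≤∧≢⇒< (≮⇒≥ a≮b) (λ eq → a≢b (toℕ-injective (sym eq))) ,
                  trans (ColoredMultigraph.sym G col b a) no-edge

  EndpointsIn : ∀ {m} → (Fin m → Fin n) → Slot n → Set
  EndpointsIn emb (_ , u , v) = (∃[ x ] emb x ≡ u) × (∃[ y ] emb y ≡ v)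

  canon-endpointsIn : ∀ {m} (emb : Fin m → Fin n) col x y → EndpointsIn emb (canon col (emb x) (emb y))
  canon-endpointsIn emb col x y with emb x <? emb y
  ... | yes _ = (x , refl) , (y , refl)
  ... | no  _ = (y , refl) , (x , refl)

<⇒≡ᵇ≡false : ∀ {m n} → m < n → (m ≡ᵇ n) ≡ false
<⇒≡ᵇ≡false {zero}  {suc n} _         = refl
<⇒≡ᵇ≡false {suc m} {suc n} (s≤s m<n) = <⇒≡ᵇ≡false m<n

≡ᵇ-refl : ∀ n → (n ≡ᵇ n) ≡ true
≡ᵇ-refl zero    = refl
≡ᵇ-refl (suc n) = ≡ᵇ-refl n

parityColour : Parity → Fin 2
parityColour 0ℙ = fzero
parityColour 1ℙ = fsuc fzero

colour : ℕ → Fin 2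
colour j = parityColour (parity j)

colour-suc : ∀ j → colour j ≢ colour (suc j)
colour-suc j rewrite parity-suc j with parity j
... | 0ℙ = λ ()
... | 1ℙ = λ ()

ProperCycleOrAbsentSlots : ∀ {m n} → ColoredMultigraph 2 n → (Fin (suc m) → Fin n) → Set
ProperCycleOrAbsentSlots {m} {n} G emb = ProperCycle G (suc m) ⊎
  Σ[ ts ∈ (Fin m → Slot n) ] Injective _≡_ _≡_ ts × (∀ c → Absent G (ts c) × EndpointsIn emb (ts c))

module Walecki (p : ℕ) (q-odd : parity (suc p) ≡ 1ℙ) where

  q : ℕ
  q = suc p

  -- offset j for j = 0, 1, …, q − 1 is 0, 2, −2, 4, −4, …, −(q − 1) ≡ 1 modulo q.
  offsetBy : Parity → ℕ → ℕ
  offsetBy 0ℙ j = q ∸ j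
  offsetBy 1ℙ j = suc j

  offset : ℕ → ℕ
  offset j = offsetBy (parity j) j

  -- label c j is the j-th vertex of the c-th cycle, the label q standing for ∞.
  label : ℕ → ℕ → ℕ
  label c zero    = q
  label c (suc j) = (c + offset j) % q

  pairSum : ℕ → ℕ → ℕ
  pairSum x y = (if x ≡ᵇ q then 2 * y else if y ≡ᵇ q then 2 * x else x + y) % q

  label≤q : ∀ c j → label c j ≤ q
  label≤q c zero    = ≤-refl
  label≤q c (suc j) = <⇒≤ (m%n<n (c + offset j) q)

  parity-offset : ∀ {j} → j ≤ q → parity (offset j) ≡ parity j ⁻¹
  parity-offset {j} j≤q with parity j in pj
  ... | 1ℙ = trans (parity-suc j) (cong _⁻¹ pj)
  ... | 0ℙ = begin
    parity (q ∸ j)                  ≡⟨ ℙ-+-identityʳ _ ⟨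
    parity (q ∸ j) ℙ.+ 0ℙ           ≡⟨ cong (parity (q ∸ j) ℙ.+_) pj ⟨
    parity (q ∸ j) ℙ.+ parity j     ≡⟨ +-homo-+ (q ∸ j) j ⟨
    parity (q ∸ j + j)              ≡⟨ cong parity (m∸n+n≡m j≤q) ⟩
    parity q                        ≡⟨ q-odd ⟩
    1ℙ                              ∎
    where open ≡-Reasoning

  offset-injective : ∀ {j j′} → j < q → j′ < q → offset j ≡ offset j′ → j ≡ j′
  offset-injective {j} {j′} j<q j′<q eq = by-parity (parity j) (parity j′) same-parity eq
    where
    same-parity : parity j ≡ parity j′
    same-parity = ⁻¹-injective (begin
      parity j ⁻¹          ≡⟨ parity-offset (<⇒≤ j<q) ⟨
      parity (offset j)    ≡⟨ cong parity eq ⟩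
      parity (offset j′)   ≡⟨ parity-offset (<⇒≤ j′<q) ⟩
      parity j′ ⁻¹         ∎)
      where open ≡-Reasoning
    by-parity : ∀ a a′ → a ≡ a′ → offsetBy a j ≡ offsetBy a′ j′ → j ≡ j′
    by-parity 0ℙ 0ℙ _ eq = ∸-cancelˡ-≡ (<⇒≤ j<q) (<⇒≤ j′<q) eq
    by-parity 1ℙ 1ℙ _ eq = suc-injective eq

  offset-window : ∀ c {j j′} → j < q → j′ < q → c + offset j′ < c + offset j + q
  offset-window c {j} {j′} j<q j′<q = begin-strict
    c + offset j′       ≤⟨ +-monoʳ-≤ c (offset≤q j′<q) ⟩
    c + q               <⟨ +-monoʳ-< c (m<n+m q (0<offset j<q)) ⟩
    c + (offset j + q)  ≡⟨ +-assoc c (offset j) q ⟨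
    c + offset j + q    ∎
    where
    open ≤-Reasoning
    0<offset : ∀ {j} → j < q → 0 < offset j
    0<offset {j} j<q with parity j
    ... | 0ℙ = m<n⇒0<n∸m j<q
    ... | 1ℙ = z<s
    offset≤q : ∀ {j} → j < q → offset j ≤ q
    offset≤q {j} j<q with parity j
    ... | 0ℙ = m∸n≤m q j
    ... | 1ℙ = j<q

  label-injective : ∀ c {j j′} → j ≤ q → j′ ≤ q → label c j ≡ label c j′ → j ≡ j′
  label-injective c {zero}  {zero}   _ _ _  = refl
  label-injective c {zero}  {suc j′} _ _ eq = contradiction (sym eq) (<⇒≢ (m%n<n (c + offset j′) q))
  label-injective c {suc j} {zero}   _ _ eq = contradiction eq (<⇒≢ (m%n<n (c + offset j) q))
  label-injective c {suc j} {suc j′} j<q j′<q eq = cong suc (offset-injective j<q j′<q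
    (+-cancelˡ-≡ c _ _ (%-injective-window eq (offset-window c j′<q j<q) (offset-window c j<q j′<q))))

  pairSum-comm : ∀ x y → pairSum x y ≡ pairSum y x
  pairSum-comm x y with x ≡ᵇ q in x≡ᵇq | y ≡ᵇ q in y≡ᵇq
  ... | true  | true  = cong (λ z → (2 * z) % q) (trans (is-q y y≡ᵇq) (sym (is-q x x≡ᵇq)))
    where
    is-q : ∀ z → (z ≡ᵇ q) ≡ true → z ≡ q
    is-q z eq = ≡ᵇ⇒≡ z q (Equivalence.from T-≡ eq)
  ... | true  | false = refl
  ... | false | true  = refl
  ... | false | false = cong (_% q) (+-comm x y)

  offsets-sum : ∀ {j} → suc j < q → offset j + offset (suc j) ≡ q + 2 * toℕ (colour (suc j))
  offsets-sum {j} 1+j<q rewrite parity-suc j with parity j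
  ... | 1ℙ = trans (m+[n∸m]≡n (<⇒≤ 1+j<q)) (sym (+-identityʳ q))
  ... | 0ℙ = begin
    (q ∸ j) + (2 + j)    ≡⟨ cong (q ∸ j +_) (+-comm 2 j) ⟩
    (q ∸ j) + (j + 2)    ≡⟨ +-assoc (q ∸ j) j 2 ⟨
    (q ∸ j) + j + 2      ≡⟨ cong (_+ 2) (m∸n+n≡m (<⇒≤ (<-trans (n<1+n j) 1+j<q))) ⟩
    q + 2                ∎
    where open ≡-Reasoning

  label-key : ∀ c j → c < q → j < q →
              pairSum (label c j) (label c (suc j)) ≡ (2 * toℕ (colour j) + 2 * c) % q
  label-key c zero c<q _ rewrite ≡ᵇ-refl q =
    cong (λ x → (2 * x) % q) (trans ([m+n]%n≡m%n c q) (m<n⇒m%n≡m c<q))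
  label-key c (suc j) c<q 1+j<q
    rewrite <⇒≡ᵇ≡false (m%n<n (c + offset j) q) | <⇒≡ᵇ≡false (m%n<n (c + offset (suc j)) q) = begin
    ((c + a) % q + (c + b) % q) % q      ≡⟨ %-distribˡ-+ (c + a) (c + b) q ⟨
    ((c + a) + (c + b)) % q              ≡⟨ cong (_% q) (regroup c a b) ⟩
    ((a + b) + 2 * c) % q                ≡⟨ cong (λ s → (s + 2 * c) % q) (offsets-sum 1+j<q) ⟩
    ((q + 2 * bit) + 2 * c) % q          ≡⟨ cong (_% q) (+-assoc q (2 * bit) (2 * c)) ⟩
    (q + (2 * bit + 2 * c)) % q          ≡⟨ %-remove-+ˡ (2 * bit + 2 * c) ∣-refl ⟩
    (2 * bit + 2 * c) % q                ∎
    where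
    open ≡-Reasoning
    open +-*-Solver
    a b bit : ℕ
    a = offset j
    b = offset (suc j)
    bit = toℕ (colour (suc j))
    regroup : ∀ c a b → (c + a) + (c + b) ≡ (a + b) + 2 * c
    regroup = solve 3 (λ c a b → (c :+ a) :+ (c :+ b) := (a :+ b) :+ con 2 :* c) refl

  label-key-last : ∀ c → pairSum (label c q) (label c 0) ≡ (2 * toℕ (colour q) + 2 * c) % q
  label-key-last c
    rewrite ⁻¹-injective (trans (sym (parity-suc p)) q-odd) | m+n∸n≡m 1 p
          | <⇒≡ᵇ≡false (m%n<n (c + 1) q) | ≡ᵇ-refl q | q-odd = begin
    (2 * ((c + 1) % q)) % q                ≡⟨ cong (λ x → ((c + 1) % q + x) % q) (+-identityʳ _) ⟩
    ((c + 1) % q + (c + 1) % q) % q        ≡⟨ %-distribˡ-+ (c + 1) (c + 1) q ⟨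
    ((c + 1) + (c + 1)) % q                ≡⟨ cong (_% q) (double c) ⟩
    (2 + 2 * c) % q                        ∎
    where
    open ≡-Reasoning
    open +-*-Solver
    double : ∀ c → (c + 1) + (c + 1) ≡ 2 + 2 * c
    double = solve 1 (λ c → (c :+ con 1) :+ (c :+ con 1) := con 2 :+ con 2 :* c) refl

  vertex : Fin q → Fin (suc q) → Fin (suc q)
  vertex c i = fromℕ< (s≤s (label≤q (toℕ c) (toℕ i)))

  toℕ-vertex : ∀ c i → toℕ (vertex c i) ≡ label (toℕ c) (toℕ i)
  toℕ-vertex c i = toℕ-fromℕ< (s≤s (label≤q (toℕ c) (toℕ i)))

  vertex-injective : ∀ c → Injective _≡_ _≡_ (vertex c)
  vertex-injective c {i} {j} eq = toℕ-injective
    (label-injective (toℕ c) (toℕ≤pred[n] i) (toℕ≤pred[n] j)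
      (trans (sym (toℕ-vertex c i)) (trans (cong toℕ eq) (toℕ-vertex c j))))

  colour-alternates : ∀ (i : Fin (suc q)) → colour (toℕ i) ≢ colour (toℕ (next i))
  colour-alternates i with view i
  ... | ‵fromℕ rewrite next-fromℕ q | toℕ-fromℕ q | q-odd = λ ()
  ... | ‵inj₁ {i = j} _ rewrite toℕ-next-inject₁ j | toℕ-inject₁ j = colour-suc (toℕ j)

  edge-key : ∀ c i → pairSum (toℕ (vertex c i)) (toℕ (vertex c (next i))) ≡
                     (2 * toℕ (colour (toℕ i)) + 2 * toℕ c) % q
  edge-key c i rewrite toℕ-vertex c i | toℕ-vertex c (next i) with view i
  ... | ‵fromℕ rewrite next-fromℕ q | toℕ-fromℕ p = label-key-last (toℕ c)
  ... | ‵inj₁ {i = j} _ rewrite toℕ-next-inject₁ j | toℕ-inject₁ j =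
    label-key (toℕ c) (toℕ j) (toℕ<n c) (toℕ<n j)

  cycles-edge-disjoint : ∀ {c c′ i i′} → colour (toℕ i) ≡ colour (toℕ i′) →
                         (vertex c i , vertex c (next i)) ≐ (vertex c′ i′ , vertex c′ (next i′)) →
                         c ≡ c′
  cycles-edge-disjoint {c} {c′} {i} {i′} same-colour same-ends = toℕ-injective
    (+-*-%-injective (parity≡1ℙ⇒coprime-2 q-odd) (2 * b) same-key (toℕ<n c) (toℕ<n c′))
    where
    open ≡-Reasoning
    b : ℕ
    b = toℕ (colour (toℕ i))
    key : Fin (suc q) → Fin (suc q) → ℕ
    key x y = pairSum (toℕ x) (toℕ y)
    key-comm : ∀ x y → key x y ≡ key y x
    key-comm x y = pairSum-comm (toℕ x) (toℕ y)
    same-key : (2 * b + 2 * toℕ c) % q ≡ (2 * b + 2 * toℕ c′) % q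
    same-key = begin
      (2 * b + 2 * toℕ c) % q                      ≡⟨ edge-key c i ⟨
      key (vertex c i) (vertex c (next i))         ≡⟨ resp-≐ key key-comm same-ends ⟩
      key (vertex c′ i′) (vertex c′ (next i′))     ≡⟨ edge-key c′ i′ ⟩
      (2 * toℕ (colour (toℕ i′)) + 2 * toℕ c′) % q
        ≡⟨ cong (λ b′ → (2 * toℕ b′ + 2 * toℕ c′) % q) same-colour ⟨
      (2 * b + 2 * toℕ c′) % q                     ∎

  module _ {n} (G : ColoredMultigraph 2 n) (emb : Fin (suc q) → Fin n)
           (emb-injective : Injective _≡_ _≡_ emb) where

    cycleSlot : Fin q → Fin (suc q) → Slot n
    cycleSlot c i = canon (colour (toℕ i)) (emb (vertex c i)) (emb (vertex c (next i)))

    cycleSlot-injective : ∀ {c c′} i i′ → cycleSlot c i ≡ cycleSlot c′ i′ → c ≡ c′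
    cycleSlot-injective i i′ eq with canon-injective eq
    ... | same-colour , same-ends =
      cycles-edge-disjoint {i = i} {i′} same-colour (≐-injective emb-injective same-ends)

    CyclePresent : Fin q → Set
    CyclePresent c = ∀ i → T (edge G (colour (toℕ i)) (emb (vertex c i)) (emb (vertex c (next i))))

    present⇒properCycle : 2 ≤ q → ∀ c → CyclePresent c → ProperCycle G (suc q)
    present⇒properCycle 2≤q c c-present = record
      { length≥3 = s≤s 2≤q
      ; vs       = λ i → emb (vertex c i)
      ; distinct = λ eq → vertex-injective c (emb-injective eq)
      ; cs       = λ i → colour (toℕ i)
      ; edges    = c-present
      ; proper   = colour-alternates
      }

    proper-cycle-or-absent-slots : 2 ≤ q → ProperCycleOrAbsentSlots G emb
    proper-cycle-or-absent-slots 2≤q with any? (λ c → all? (λ i → T? _))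
    ... | yes (c , c-present) = inj₁ (present⇒properCycle 2≤q c c-present)
    ... | no none-present     =
      inj₂ (ts , ts-injective , λ c → ts-absent c , canon-endpointsIn emb _ _ _)
      where
      missing : ∀ c → ∃[ i ] ¬ T (edge G (colour (toℕ i)) (emb (vertex c i))
                                                          (emb (vertex c (next i))))
      missing c = ¬∀⟶∃¬ _ _ (λ i → T? _) (λ c-present → none-present (c , c-present))
      gap : Fin q → Fin (suc q)
      gap c = proj₁ (missing c)
      ts : Fin q → Slot n
      ts c = cycleSlot c (gap c)
      ts-injective : Injective _≡_ _≡_ ts
      ts-injective {c} {c′} = cycleSlot-injective (gap c) (gap c′)
      ts-absent : ∀ c → Absent G (ts c)
      ts-absent c = canon-absent G
        (λ eq → colour-alternates (gap c)
           (cong (colour ∘ toℕ) (vertex-injective c {gap c} {next (gap c)} (emb-injective eq))))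
        (¬-not (proj₂ (missing c) ∘ Equivalence.from T-≡))

∷-injective : ∀ {A : Set} {k} {x : A} {f : Fin k → A} →
              (∀ i → x ≢ f i) → Injective _≡_ _≡_ f → Injective _≡_ _≡_ (x Vector.∷ f)
∷-injective x∉f f-inj {fzero}  {fzero}  _  = refl
∷-injective x∉f f-inj {fzero}  {fsuc j} eq = contradiction eq (x∉f j)
∷-injective x∉f f-inj {fsuc i} {fzero}  eq = contradiction (sym eq) (x∉f i)
∷-injective x∉f f-inj {fsuc i} {fsuc j} eq = cong fsuc (f-inj eq)

2*[1+n]C2≡2*nC2+n+n : ∀ n → 2 * (suc n C 2) ≡ 2 * (n C 2) + n + n
2*[1+n]C2≡2*nC2+n+n n = begin
  2 * (suc n C 2)        ≡⟨ cong (2 *_) (nCk+nC[k+1]≡[n+1]C[k+1] n 1) ⟨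
  2 * (n C 1 + n C 2)    ≡⟨ cong (λ m → 2 * (m + n C 2)) (nC1≡n n) ⟩
  2 * (n + n C 2)        ≡⟨ solve 2 (λ n c → con 2 :* (n :+ c) := con 2 :* c :+ n :+ n) refl n (n C 2) ⟩
  2 * (n C 2) + n + n    ∎
  where
  open ≡-Reasoning
  open +-*-Solver

dense⇒¬absent-slots : ∀ {k} (G : ColoredMultigraph 2 (suc k)) → 2 * (k C 2) + suc k ≤ numEdges G →
                      (ts : Fin k → Slot (suc k)) → Injective _≡_ _≡_ ts → ¬ (∀ i → Absent G (ts i))
dense⇒¬absent-slots {k} G dense ts ts-inj absent = <-irrefl refl (begin-strict
  2 * (suc k C 2)          ≡⟨ 2*[1+n]C2≡2*nC2+n+n k ⟩
  2 * (k C 2) + k + k      <⟨ +-monoˡ-< k (+-monoʳ-< (2 * (k C 2)) (n<1+n k)) ⟩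
  2 * (k C 2) + suc k + k  ≤⟨ +-monoˡ-≤ k dense ⟩
  numEdges G + k           ≤⟨ numEdges-bound G ts ts-inj absent ⟩
  2 * (suc k C 2)          ∎)
  where open ≤-Reasoning

dense⇒hamiltonian : ∀ p (G : ColoredMultigraph 2 (2 + p)) → parity (suc p) ≡ 1ℙ → 1 ≤ p →
                    2 * (suc p C 2) + (2 + p) ≤ numEdges G → ProperCycle G (2 + p)
dense⇒hamiltonian p G q-odd 1≤p dense
  with Walecki.proper-cycle-or-absent-slots p q-odd G id id (s≤s 1≤p)
... | inj₁ cycle                 = cycle
... | inj₂ (ts , ts-inj , absent) = ⊥-elim (dense⇒¬absent-slots G dense ts ts-inj (proj₁ ∘ absent))

punchIn-avoids : ∀ {n} (u : Fin (suc n)) {s} → EndpointsIn (punchIn u) s → ∀ col v → (col , u , v) ≢ s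
punchIn-avoids u ((x , punchIn-x≡u) , _) col v refl = punchInᵢ≢i u x punchIn-x≡u

module _ p (G : ColoredMultigraph 2 (3 + p)) (q-odd : parity (suc p) ≡ 1ℙ) (1≤p : 1 ≤ p) where

  private
    avoiding : ∀ u → ProperCycleOrAbsentSlots G (punchIn u)
    avoiding u = Walecki.proper-cycle-or-absent-slots p q-odd G (punchIn u) (punchIn-injective u _ _) (s≤s 1≤p)

  dense⇒almost-hamiltonian : 2 * ((2 + p) C 2) + (3 + p) ≤ numEdges G → ProperCycle G (2 + p)
  dense⇒almost-hamiltonian dense with avoiding fzero
  ... | inj₁ cycle               = cycle
  ... | inj₂ (ts₀ , _ , absent₀) with ts₀ fzero | proj₁ (absent₀ fzero)
  ...   | col , u , v | t-absent with avoiding u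
  ...     | inj₁ cycle                  = cycle
  ...     | inj₂ (ts , ts-inj , absent) = ⊥-elim (dense⇒¬absent-slots G dense ((col , u , v) Vector.∷ ts)
            (∷-injective (λ c → punchIn-avoids u (proj₂ (absent c)) col v) ts-inj)
            λ { fzero → t-absent ; (fsuc c) → proj₁ (absent c) })

theorem3 : (n : ℕ) → n ≥ 4 → (G : ColoredMultigraph 2 n) → Connected G →
    numEdges G ≥ 2 * ((n ∸ 1) C 2) + n →
    (2 ∣ n → ProperHamiltonianCycle G) × (¬ (2 ∣ n) → ProperCycle G (n ∸ 1))
theorem3 (suc (suc (suc (suc k)))) (s≤s (s≤s (s≤s (s≤s _)))) G _ dense =
  (λ 2∣n → dense⇒hamiltonian (2 + k) G (2∣suc⇒parity≡1ℙ 2∣n) (s≤s z≤n) dense) ,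
  (λ 2∤n → dense⇒almost-hamiltonian (1 + k) G (¬2∣⇒parity≡1ℙ 2∤n) (s≤s z≤n) dense)
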